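{- Let $\mathcal{S}\subseteq\mathbb{Z}^2$ be a finite shape, and let $\mathcal{A}$ be a doubly periodic $\mathcal{S}$-DDC of density $\delta$. Then there exists a set of at least $\lceil\delta|\mathcal{S}|\rceil$ dots contained in $\mathcal{S}$ that form a DDC.
   Context: A shape is a set of positions of the square grid $\mathbb{Z}^2$; $(i,j)+\mathcal{S}=\{(i+i',j+j'):(i',j')\in\mathcal{S}\}$. An array of dots $\mathcal{A}\subseteq\mathbb{Z}^2$ is doubly periodic with period $(\eta,\kappa)$ ($\eta,\kappa$ positive integers) if $(i,j)$ is a dot iff $(i+\eta,j)$ is a dot iff $(i,j+\kappa)$ is a dot, for all $i,j$; its density is $d/(\eta\kappa)$, where $d$ is the number of dots in any set $\{(i_0+i,j_0+j):0\le i\le\eta-1,0\le j\le\kappa-1\}$. A set of dots is a DDC if the vectors $x-y$, over ordered pairs $(x,y)$ of distinct dots, are pairwise distinct. $\mathcal{A}$ is a doubly periodic $\mathcal{S}$-DDC if it is doubly periodic and the dots contained in every shift $(i,j)+\mathcal{S}$ form a DDC. -}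

module Defs where

open import Data.Bool using (Bool; true; false; T)
open import Data.Nat as ℕ using (ℕ; NonZero)
open import Data.Nat.Properties using (m*n≢0)
open import Data.Integer as ℤ using (ℤ; +_)
open import Data.Product using (_×_; _,_)
open import Data.List using (List; length; filter; concatMap; map; upTo)
open import Data.List.Membership.Propositional using (_∈_)
open import Data.Rational as ℚ using (ℚ)
open import Relation.Binary.PropositionalEquality using (_≡_; _≢_)
open import Relation.Unary using (Pred)
open import Level using (0ℓ)
open import Relation.Nullary.Decidable using (does)
open import Data.Bool using (_≟_)

Pos : Set
Pos = ℤ × ℤ

_⊕_ : Pos → Pos → Pos
(a , b) ⊕ (c , d) = (a ℤ.+ c , b ℤ.+ d)

_⊖_ : Pos → Pos → Pos
(a , b) ⊖ (c , d) = (a ℤ.- c , b ℤ.- d)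

-- a finite shape is given by a duplicate-free list (Unique is assumed in
-- the theorem); its cardinality is the length of the list.

InShift : Pos → List Pos → Pos → Set
InShift v S x = Data.Product.∃ λ s → s ∈ S × x ≡ v ⊕ s
  where import Data.Product

IsDDC : Pred Pos 0ℓ → Set
IsDDC P = ∀ x y u v → P x → P y → P u → P v → x ≢ y → u ≢ v →
          (x , y) ≢ (u , v) → x ⊖ y ≢ u ⊖ v

Array : Set
Array = Pos → Bool

Dot : Array → Pos → Set
Dot A x = T (A x)

DoublyPeriodic : Array → ℕ → ℕ → Set
DoublyPeriodic A η κ = ∀ i j →
  (A (i , j) ≡ A (i ℤ.+ + η , j)) × (A (i , j) ≡ A (i , j ℤ.+ + κ))

window : Pos → ℕ → ℕ → List Pos
window (i₀ , j₀) η κ =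
  concatMap (λ i → map (λ j → (i₀ ℤ.+ + i , j₀ ℤ.+ + j)) (upTo κ)) (upTo η)

dotsInPeriod : Array → ℕ → ℕ → ℕ
dotsInPeriod A η κ = length (filter (λ x → A x ≟ true) (window (+ 0 , + 0) η κ))

density : Array → (η κ : ℕ) → .{{NonZero η}} → .{{NonZero κ}} → ℚ
density A η κ = (+ dotsInPeriod A η κ) ℚ./ (η ℕ.* κ)
  where instance _ = m*n≢0 η κ

IsShapeDDC : List Pos → Array → Set
IsShapeDDC S A = ∀ v → IsDDC (λ x → InShift v S x × Dot A x)

-- Count the dots of the shifts v + S over all v in one period window W. By double
-- periodicity each position s ∈ S meets exactly d dots as v runs over W, so the
-- total is d·|S| and some shift v + S holds at least d·|S|/(ηκ) = δ|S| dots, hence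
-- at least ⌈δ|S|⌉. These dots form a DDC, and translating them back by −v gives
-- a DDC contained in S, since translation preserves differences.
module Submission where

open import Defs
open import Data.Nat using (ℕ; NonZero)
open import Data.Integer using (+_; _≤_)
open import Data.Rational using (ℚ; _*_; _/_; ceiling)
open import Data.Product using (∃; _×_)
open import Data.List using (List; length)
open import Data.List.Membership.Propositional using (_∈_)
open import Data.List.Relation.Unary.Unique.Propositional using (Unique)

open import Data.Bool using (Bool; true; false; T; _≟_)
open import Data.Unit using (tt)
open import Data.Nat as ℕ using (zero; suc)
import Data.Nat.Properties as ℕₚ
open import Algebra.Properties.CommutativeSemigroup ℕₚ.+-commutativeSemigroup using (interchange)
open import Data.Integer as ℤ using (ℤ; -[1+_])
import Data.Integer.Properties as ℤₚ
open import Data.Integer.DivMod using (div-pos-is-/ℕ; n<s[n/ℕd]*d)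
open import Data.Integer.Tactic.RingSolver using (solve-∀)
open import Algebra.Properties.AbelianGroup ℤₚ.+-0-abelianGroup using () renaming (∙-cancelˡ to +-cancelˡ)
open import Data.Rational as ℚ using (↥_; ↧_; ↧ₙ_; floor)
import Data.Rational.Properties as ℚₚ
import Data.Rational.Unnormalised as ℚᵘ
import Data.Rational.Unnormalised.Properties as ℚᵘₚ
open import Data.Product using (_,_; proj₁; proj₂)
open import Data.List using ([]; _∷_; _++_; filter; concatMap; map; upTo)
import Data.List.Properties as List
open import Data.List.Membership.Propositional.Properties using (∈-filter⁻)
open import Data.List.Relation.Unary.Unique.Propositional.Properties using (filter⁺)
open import Function using (_∘_)
open import Relation.Binary.PropositionalEquality
open import Relation.Nullary using (yes; no)

private
  variable
    X Y : Set

toℕ : Bool → ℕ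
toℕ true  = 1
toℕ false = 0

∑ : List X → (X → ℕ) → ℕ
∑ []       f = 0
∑ (x ∷ xs) f = f x ℕ.+ ∑ xs f

∑-cong : {f g : X → ℕ} → (∀ x → f x ≡ g x) → ∀ xs → ∑ xs f ≡ ∑ xs g
∑-cong f≗g []       = refl
∑-cong f≗g (x ∷ xs) = cong₂ ℕ._+_ (f≗g x) (∑-cong f≗g xs)

∑-++ : ∀ (xs ys : List X) f → ∑ (xs ++ ys) f ≡ ∑ xs f ℕ.+ ∑ ys f
∑-++ []       ys f = refl
∑-++ (x ∷ xs) ys f = trans (cong (f x ℕ.+_) (∑-++ xs ys f)) (sym (ℕₚ.+-assoc (f x) _ _))

∑-map : ∀ (g : X → Y) xs f → ∑ (map g xs) f ≡ ∑ xs (f ∘ g)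
∑-map g []       f = refl
∑-map g (x ∷ xs) f = cong (f (g x) ℕ.+_) (∑-map g xs f)

∑-concatMap : ∀ (g : X → List Y) xs f → ∑ (concatMap g xs) f ≡ ∑ xs (λ x → ∑ (g x) f)
∑-concatMap g []       f = refl
∑-concatMap g (x ∷ xs) f =
  trans (∑-++ (g x) (concatMap g xs) f) (cong (∑ (g x) f ℕ.+_) (∑-concatMap g xs f))

∑-distrib-+ : ∀ xs (f g : X → ℕ) → ∑ xs (λ x → f x ℕ.+ g x) ≡ ∑ xs f ℕ.+ ∑ xs g
∑-distrib-+ []       f g = refl
∑-distrib-+ (x ∷ xs) f g =
  trans (cong (f x ℕ.+ g x ℕ.+_) (∑-distrib-+ xs f g)) (interchange (f x) (g x) (∑ xs f) (∑ xs g))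

∑-const : ∀ (xs : List X) k → ∑ xs (λ _ → k) ≡ length xs ℕ.* k
∑-const []       k = refl
∑-const (x ∷ xs) k = cong (k ℕ.+_) (∑-const xs k)

∑-comm : ∀ xs (ys : List Y) (f : X → Y → ℕ) →
  ∑ xs (λ x → ∑ ys (f x)) ≡ ∑ ys (λ y → ∑ xs (λ x → f x y))
∑-comm []       ys f = trans (sym (ℕₚ.*-zeroʳ (length ys))) (sym (∑-const ys 0))
∑-comm (x ∷ xs) ys f =
  trans (cong (∑ ys (f x) ℕ.+_) (∑-comm xs ys f)) (sym (∑-distrib-+ ys (f x) _))

length-filter≡∑ : ∀ (b : X → Bool) xs → length (filter (λ x → b x ≟ true) xs) ≡ ∑ xs (toℕ ∘ b)
length-filter≡∑ b []       = refl
length-filter≡∑ b (x ∷ xs) with b x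
... | true  = cong suc (length-filter≡∑ b xs)
... | false = length-filter≡∑ b xs

-- The default x₀ is only returned for the empty list, where any witness works.
exists-above-average : ∀ (f : X → ℕ) (x₀ : X) xs → ∃ λ v → ∑ xs f ℕ.≤ f v ℕ.* length xs
exists-above-average f x₀ []       = x₀ , ℕ.z≤n
exists-above-average f x₀ (x ∷ xs) with exists-above-average f x₀ xs
... | v , ∑≤fv*n with f v ℕ.≤? f x
...   | yes fv≤fx = x , (begin
  f x ℕ.+ ∑ xs f              ≤⟨ ℕₚ.+-monoʳ-≤ (f x) ∑≤fv*n ⟩
  f x ℕ.+ f v ℕ.* length xs   ≤⟨ ℕₚ.+-monoʳ-≤ (f x) (ℕₚ.*-monoˡ-≤ (length xs) fv≤fx) ⟩
  f x ℕ.+ f x ℕ.* length xs   ≡⟨ ℕₚ.*-suc (f x) (length xs) ⟨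
  f x ℕ.* suc (length xs)     ∎)
  where open ℕₚ.≤-Reasoning
...   | no fv≰fx = v , (begin
  f x ℕ.+ ∑ xs f              ≤⟨ ℕₚ.+-mono-≤ (ℕₚ.<⇒≤ (ℕₚ.≰⇒> fv≰fx)) ∑≤fv*n ⟩
  f v ℕ.+ f v ℕ.* length xs   ≡⟨ ℕₚ.*-suc (f v) (length xs) ⟨
  f v ℕ.* suc (length xs)     ∎)
  where open ℕₚ.≤-Reasoning

∑-upTo-periodic-shift : ∀ n (g : ℤ → ℕ) → (∀ x → g (x ℤ.+ + n) ≡ g x) →
  ∀ c → ∑ (upTo n) (λ i → g (+ i ℤ.+ c)) ≡ ∑ (upTo n) (g ∘ +_)
∑-upTo-periodic-shift n g periodic c =
  trans (shift-invariant c) (∑-cong (λ i → cong g (ℤₚ.+-identityʳ (+ i))) (upTo n))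
  where
  sumFrom : ℤ → ℕ
  sumFrom c = ∑ (upTo n) (λ i → g (+ i ℤ.+ c))

  ∑-upTo-suc-head : ∀ (f : ℕ → ℕ) → ∑ (upTo (suc n)) f ≡ f 0 ℕ.+ ∑ (upTo n) (f ∘ suc)
  ∑-upTo-suc-head f = cong (f 0 ℕ.+_)
    (trans (cong (λ xs → ∑ xs f) (sym (List.map-upTo suc n))) (∑-map suc (upTo n) f))

  ∑-upTo-suc-last : ∀ (f : ℕ → ℕ) → ∑ (upTo (suc n)) f ≡ ∑ (upTo n) f ℕ.+ f n
  ∑-upTo-suc-last f = trans (cong (λ xs → ∑ xs f) (sym (List.upTo-∷ʳ n)))
    (trans (∑-++ (upTo n) (n ∷ []) f) (cong (∑ (upTo n) f ℕ.+_) (ℕₚ.+-identityʳ (f n))))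

  -- Moving the window by one drops g c and adds g (n + c), which is equal.
  shift-by-one : ∀ c → sumFrom (+ 1 ℤ.+ c) ≡ sumFrom c
  shift-by-one c = ℕₚ.+-cancelˡ-≡ (g c) _ _ (begin
    g c ℕ.+ sumFrom (+ 1 ℤ.+ c)              ≡⟨ cong₂ ℕ._+_ (cong g (sym (ℤₚ.+-identityˡ c))) (∑-cong reassoc (upTo n)) ⟩
    f 0 ℕ.+ ∑ (upTo n) (f ∘ suc)              ≡⟨ ∑-upTo-suc-head f ⟨
    ∑ (upTo (suc n)) f                        ≡⟨ ∑-upTo-suc-last f ⟩
    sumFrom c ℕ.+ f n                         ≡⟨ cong (sumFrom c ℕ.+_) (trans (cong g (ℤₚ.+-comm (+ n) c)) (periodic c)) ⟩
    sumFrom c ℕ.+ g c                         ≡⟨ ℕₚ.+-comm (sumFrom c) (g c) ⟩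
    g c ℕ.+ sumFrom c                         ∎)
    where
    open ≡-Reasoning
    f : ℕ → ℕ
    f i = g (+ i ℤ.+ c)
    reassoc : ∀ i → g (+ i ℤ.+ (+ 1 ℤ.+ c)) ≡ f (suc i)
    reassoc i = cong g (trans (sym (ℤₚ.+-assoc (+ i) (+ 1) c)) (cong (ℤ._+ c) (ℤₚ.+-comm (+ i) (+ 1))))

  shift-by : ∀ k c → sumFrom (+ k ℤ.+ c) ≡ sumFrom c
  shift-by zero    c = cong sumFrom (ℤₚ.+-identityˡ c)
  shift-by (suc k) c =
    trans (cong sumFrom (ℤₚ.+-assoc (+ 1) (+ k) c)) (trans (shift-by-one (+ k ℤ.+ c)) (shift-by k c))

  shift-invariant : ∀ c → sumFrom c ≡ sumFrom (+ 0)
  shift-invariant (+ k)     = trans (cong sumFrom (sym (ℤₚ.+-identityʳ (+ k)))) (shift-by k (+ 0))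
  shift-invariant -[1+ k ] = trans (sym (shift-by (suc k) -[1+ k ])) (cong sumFrom (ℤₚ.n⊖n≡0 (suc k)))

∑-upTo-const : ∀ n k → ∑ (upTo n) (λ _ → k) ≡ n ℕ.* k
∑-upTo-const n k = trans (∑-const (upTo n) k) (cong (ℕ._* k) (List.length-upTo n))

∑-window : ∀ η κ (f : Pos → ℕ) →
  ∑ (window (+ 0 , + 0) η κ) f ≡ ∑ (upTo η) (λ i → ∑ (upTo κ) (λ j → f (+ i , + j)))
∑-window η κ f = trans (∑-concatMap _ (upTo η) f) (∑-cong (λ i → ∑-map _ (upTo κ) f) (upTo η))

length-window : ∀ η κ → length (window (+ 0 , + 0) η κ) ≡ η ℕ.* κ
length-window η κ = begin
  length W                                  ≡⟨ ℕₚ.*-identityʳ (length W) ⟨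
  length W ℕ.* 1                            ≡⟨ ∑-const W 1 ⟨
  ∑ W (λ _ → 1)                             ≡⟨ ∑-window η κ _ ⟩
  ∑ (upTo η) (λ _ → ∑ (upTo κ) (λ _ → 1))   ≡⟨ ∑-cong (λ _ → trans (∑-upTo-const κ 1) (ℕₚ.*-identityʳ κ)) (upTo η) ⟩
  ∑ (upTo η) (λ _ → κ)                      ≡⟨ ∑-upTo-const η κ ⟩
  η ℕ.* κ                                   ∎
  where
  open ≡-Reasoning
  W = window (+ 0 , + 0) η κ

module _ {A : Array} {η κ : ℕ} (periodic : DoublyPeriodic A η κ) where

  private
    W = window (+ 0 , + 0) η κ

  ∑-window-shift : ∀ s → ∑ W (λ v → toℕ (A (v ⊕ s))) ≡ ∑ W (toℕ ∘ A)
  ∑-window-shift (s₁ , s₂) = begin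
    ∑ W (λ v → toℕ (A (v ⊕ (s₁ , s₂))))                          ≡⟨ ∑-window η κ _ ⟩
    ∑ (upTo η) (λ i → ∑ (upTo κ) (λ j → toℕ (A (+ i ℤ.+ s₁ , + j ℤ.+ s₂))))
      ≡⟨ ∑-cong (λ i → ∑-upTo-periodic-shift κ (column (+ i ℤ.+ s₁)) (column-periodic _) s₂) (upTo η) ⟩
    ∑ (upTo η) (λ i → row (+ i ℤ.+ s₁))                          ≡⟨ ∑-upTo-periodic-shift η row row-periodic s₁ ⟩
    ∑ (upTo η) (λ i → row (+ i))                                 ≡⟨ ∑-window η κ _ ⟨
    ∑ W (toℕ ∘ A)                                                ∎
    where
    open ≡-Reasoning
    column : ℤ → ℤ → ℕ
    column x y = toℕ (A (x , y))
    column-periodic : ∀ x y → column x (y ℤ.+ + κ) ≡ column x y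
    column-periodic x y = cong toℕ (sym (proj₂ (periodic x y)))
    row : ℤ → ℕ
    row x = ∑ (upTo κ) (λ j → column x (+ j))
    row-periodic : ∀ x → row (x ℤ.+ + η) ≡ row x
    row-periodic x = ∑-cong (λ j → cong toℕ (sym (proj₁ (periodic x (+ j))))) (upTo κ)

  ∑-window-dotsInShift : ∀ (S : List Pos) →
    ∑ W (λ v → ∑ S (λ s → toℕ (A (v ⊕ s)))) ≡ length S ℕ.* dotsInPeriod A η κ
  ∑-window-dotsInShift S = begin
    ∑ W (λ v → ∑ S (λ s → toℕ (A (v ⊕ s))))   ≡⟨ ∑-comm W S _ ⟩
    ∑ S (λ s → ∑ W (λ v → toℕ (A (v ⊕ s))))   ≡⟨ ∑-cong ∑-window-shift S ⟩
    ∑ S (λ _ → ∑ W (toℕ ∘ A))                 ≡⟨ ∑-const S _ ⟩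
    length S ℕ.* ∑ W (toℕ ∘ A)                ≡⟨ cong (length S ℕ.*_) (length-filter≡∑ A W) ⟨
    length S ℕ.* dotsInPeriod A η κ           ∎
    where open ≡-Reasoning

≤-floor : ∀ p c → c ℤ.* ↧ p ≤ ↥ p → c ≤ floor p
≤-floor p@record{} c c↧p≤↥p = subst (c ≤_) (sym (div-pos-is-/ℕ (↥ p) (↧ₙ p))) c≤⌊p⌋
  where
  c<suc⌊p⌋ : c ℤ.< ℤ.suc (↥ p ℤ./ℕ ↧ₙ p)
  c<suc⌊p⌋ = ℤₚ.*-cancelʳ-<-nonNeg (↧ p) (ℤₚ.≤-<-trans c↧p≤↥p (n<s[n/ℕd]*d (↥ p) (↧ₙ p)))
  c≤⌊p⌋ : c ≤ ↥ p ℤ./ℕ ↧ₙ p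
  c≤⌊p⌋ = subst (c ≤_) (ℤₚ.pred-suc _) (ℤₚ.i<j⇒i≤pred[j] c<suc⌊p⌋)

ceiling-≤ : ∀ q c → ↥ q ≤ c ℤ.* ↧ q → ceiling q ≤ c
ceiling-≤ q@record{} c ↥q≤c↧q = begin
  ceiling q            ≡⟨⟩
  ℤ.- floor (ℚ.- q)    ≤⟨ ℤₚ.neg-mono-≤ (≤-floor (ℚ.- q) (ℤ.- c) -c↧[-q]≤↥[-q]) ⟩
  ℤ.- (ℤ.- c)          ≡⟨ ℤₚ.neg-involutive c ⟩
  c                    ∎
  where
  open ℤₚ.≤-Reasoning
  -c↧[-q]≤↥[-q] : ℤ.- c ℤ.* ↧ (ℚ.- q) ≤ ↥ (ℚ.- q)
  -c↧[-q]≤↥[-q] = subst₂ _≤_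
    (trans (ℤₚ.neg-distribˡ-* c (↧ q)) (cong (ℤ.- c ℤ.*_) (sym (ℚₚ.↧-neg q))))
    (sym (ℚₚ.↥-neg q))
    (ℤₚ.neg-mono-≤ ↥q≤c↧q)

ceiling-ratio-≤ : ∀ d n s c .{{_ : NonZero n}} → s ℕ.* d ℕ.≤ c ℕ.* n →
  ceiling ((+ d / n) * (+ s / 1)) ≤ + c
ceiling-ratio-≤ d n@(suc _) s c sd≤cn = ceiling-≤ q (+ c) ↥q≤c↧q
  where
  q : ℚ
  q = (+ d / n) * (+ s / 1)
  toℚᵘ-q : ℚ.toℚᵘ q ℚᵘ.≃ (+ d ℚᵘ./ n) ℚᵘ.* (+ s ℚᵘ./ 1)
  toℚᵘ-q = ℚᵘₚ.≃-trans (ℚₚ.toℚᵘ-homo-* (+ d / n) (+ s / 1))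
    (ℚᵘₚ.*-cong (ℚₚ.toℚᵘ-fromℚᵘ (+ d ℚᵘ./ n)) (ℚₚ.toℚᵘ-fromℚᵘ (+ s ℚᵘ./ 1)))
  ratio≤c : (+ d ℚᵘ./ n) ℚᵘ.* (+ s ℚᵘ./ 1) ℚᵘ.≤ + c ℚᵘ./ 1
  ratio≤c = ℚᵘ.*≤* (subst₂ _≤_
    (trans (cong +_ (ℕₚ.*-comm s d)) (trans (ℤₚ.pos-* d s) (sym (ℤₚ.*-identityʳ _))))
    (trans (cong (λ m → + (c ℕ.* m)) (sym (ℕₚ.*-identityʳ n))) (ℤₚ.pos-* c (n ℕ.* 1)))
    (ℤ.+≤+ sd≤cn))
  ↥q≤c↧q : ↥ q ≤ + c ℤ.* ↧ q
  ↥q≤c↧q = subst₂ _≤_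
    (trans (ℤₚ.*-identityʳ _) (ℚₚ.↥ᵘ-toℚᵘ q))
    (cong (+ c ℤ.*_) (ℚₚ.↧ᵘ-toℚᵘ q))
    (ℚᵘₚ.drop-*≤* (ℚᵘₚ.≤-respˡ-≃ (ℚᵘₚ.≃-sym toℚᵘ-q) ratio≤c))

⊕-cancelˡ : ∀ v {x y} → v ⊕ x ≡ v ⊕ y → x ≡ y
⊕-cancelˡ (v₁ , v₂) {x₁ , x₂} {y₁ , y₂} eq =
  cong₂ _,_ (+-cancelˡ v₁ x₁ y₁ (cong proj₁ eq)) (+-cancelˡ v₂ x₂ y₂ (cong proj₂ eq))

⊕-⊖-cancelˡ : ∀ v x y → (v ⊕ x) ⊖ (v ⊕ y) ≡ x ⊖ y
⊕-⊖-cancelˡ (v₁ , v₂) (x₁ , x₂) (y₁ , y₂) = cong₂ _,_ (cancel v₁ x₁ y₁) (cancel v₂ x₂ y₂)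
  where
  cancel : ∀ a b c → (a ℤ.+ b) ℤ.- (a ℤ.+ c) ≡ b ℤ.- c
  cancel = solve-∀

IsDDC-⊆ : ∀ {P Q : Pos → Set} → (∀ x → Q x → P x) → IsDDC P → IsDDC Q
IsDDC-⊆ Q⊆P ddc x y u w Qx Qy Qu Qw = ddc x y u w (Q⊆P x Qx) (Q⊆P y Qy) (Q⊆P u Qu) (Q⊆P w Qw)

IsDDC-translate : ∀ {P : Pos → Set} v → IsDDC P → IsDDC (λ x → P (v ⊕ x))
IsDDC-translate v ddc x y u w Px Py Pu Pw x≢y u≢w xy≢uw x-y≡u-w =
  ddc (v ⊕ x) (v ⊕ y) (v ⊕ u) (v ⊕ w) Px Py Pu Pw
    (x≢y ∘ ⊕-cancelˡ v) (u≢w ∘ ⊕-cancelˡ v)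
    (λ eq → xy≢uw (cong₂ _,_ (⊕-cancelˡ v (cong proj₁ eq)) (⊕-cancelˡ v (cong proj₂ eq))))
    (trans (⊕-⊖-cancelˡ v x y) (trans x-y≡u-w (sym (⊕-⊖-cancelˡ v u w))))

dotsAt : Array → Pos → List Pos → List Pos
dotsAt A v S = filter (λ s → A (v ⊕ s) ≟ true) S

module _ (A : Array) (v : Pos) (S : List Pos) where

  dotsAt-⊆ : ∀ x → x ∈ dotsAt A v S → x ∈ S
  dotsAt-⊆ x x∈D = proj₁ (∈-filter⁻ (λ s → A (v ⊕ s) ≟ true) x∈D)

  dotsAt-⊆-shift : ∀ x → x ∈ dotsAt A v S → InShift v S (v ⊕ x) × Dot A (v ⊕ x)
  dotsAt-⊆-shift x x∈D with ∈-filter⁻ (λ s → A (v ⊕ s) ≟ true) x∈D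
  ... | x∈S , dot = (x , x∈S , refl) , subst T (sym dot) tt

  dotsAt-IsDDC : IsShapeDDC S A → IsDDC (λ x → x ∈ dotsAt A v S)
  dotsAt-IsDDC S-DDC = IsDDC-⊆ dotsAt-⊆-shift (IsDDC-translate v (S-DDC v))

  length-dotsAt : length (dotsAt A v S) ≡ ∑ S (λ s → toℕ (A (v ⊕ s)))
  length-dotsAt = length-filter≡∑ (λ s → A (v ⊕ s)) S

theorem18 : (S : List Pos) → Unique S →
    (A : Array) (η κ : ℕ) .{{_ : NonZero η}} .{{_ : NonZero κ}} →
    DoublyPeriodic A η κ → IsShapeDDC S A →
    ∃ λ (D : List Pos) → Unique D × (∀ x → x ∈ D → x ∈ S) × IsDDC (λ x → x ∈ D) ×
      (ceiling (density A η κ * ((+ length S) / 1)) ≤ + length D)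
theorem18 S unique-S A η κ periodic S-DDC =
  dotsAt A v S , filter⁺ _ unique-S , dotsAt-⊆ A v S , dotsAt-IsDDC A v S S-DDC ,
  ceiling-ratio-≤ (dotsInPeriod A η κ) (η ℕ.* κ) (length S) (length (dotsAt A v S))
    {{ℕₚ.m*n≢0 η κ}} |S|d≤|D|ηκ
  where
  W = window (+ 0 , + 0) η κ
  dotsInShift : Pos → ℕ
  dotsInShift u = ∑ S (λ s → toℕ (A (u ⊕ s)))
  v = proj₁ (exists-above-average dotsInShift (+ 0 , + 0) W)
  |S|d≤|D|ηκ : length S ℕ.* dotsInPeriod A η κ ℕ.≤ length (dotsAt A v S) ℕ.* (η ℕ.* κ)
  |S|d≤|D|ηκ = begin
    length S ℕ.* dotsInPeriod A η κ       ≡⟨ ∑-window-dotsInShift periodic S ⟨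
    ∑ W dotsInShift                       ≤⟨ proj₂ (exists-above-average dotsInShift (+ 0 , + 0) W) ⟩
    dotsInShift v ℕ.* length W            ≡⟨ cong₂ ℕ._*_ (sym (length-dotsAt A v S)) (length-window η κ) ⟩
    length (dotsAt A v S) ℕ.* (η ℕ.* κ)   ∎
    where open ℕₚ.≤-Reasoning
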